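{- For any distinct terms $s,t\in\Sigma^\tau$, $WQT^*\vdash\neg(s=t)$.
   Context: Let $\mathcal{L}_T=\{0,(\cdot,\cdot),\sqsubseteq\}$. To each variable-free $\mathcal{L}_T$-term $v$ associate a term $v^\tau$ of the language $\{a,b,*,\sqsubseteq^*\}$ by $0^\tau\equiv a$, $(u,v)^\tau\equiv b*(u^\tau*v^\tau)$; $\Sigma^\tau$ is the set of all such terms $v^\tau$. $WQT^*$ is the first-order theory in the language $\{a,b,*,\sqsubseteq^*\}$ with the following axioms, where $t$ ranges over all variable-free terms of the language, $xBy\equiv\exists z\,(y=x*z)$, $xEy\equiv\exists z\,(y=z*x)$, $x\subseteq_p y\equiv x=y\vee xBy\vee xEy\vee\exists z_1,z_2\,(y=z_1*(x*z_2))\vee\exists z_1,z_2\,(y=(z_1*x)*z_2)$, and $\forall x\subseteq_p t\,\varphi$ means $\forall x(x\subseteq_p t\to\varphi)$: (WQT*1) $\forall x,y,z\,(x*(y*z)\subseteq_p t\vee(x*y)*z\subseteq_p t\to x*(y*z)=(x*y)*z)$; (WQT*2) $\forall x,y\,(x*y\subseteq_p t\to\neg(x*y=a)\wedge\neg(x*y=b))$; (WQT*3) $\forall x,y\,((a*x\subseteq_p t\wedge a*y\subseteq_p t\to(a*x=a*y\to x=y))\wedge(b*x\subseteq_p t\wedge b*y\subseteq_p t\to(b*x=b*y\to x=y))\wedge(x*a\subseteq_p t\wedge y*a\subseteq_p t\to(x*a=y*a\to x=y))\wedge(x*b\subseteq_p t\wedge y*b\subseteq_p t\to(x*b=y*b\to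 x=y)))$; (WQT*4) $\forall x,y\,((a*x\subseteq_p t\wedge b*y\subseteq_p t\to\neg(a*x=b*y))\wedge(x*a\subseteq_p t\wedge y*b\subseteq_p t\to\neg(x*a=y*b)))$; (WQT*5) $\forall x\subseteq_p t\,(x=a\vee x=b\vee((aBx\vee bBx)\wedge(aEx\vee bEx)))$; (WQT*6) $\forall y,z\,(b*(y*z)\subseteq_p t\to\forall x\,(x\sqsubseteq^* b*(y*z)\leftrightarrow x=b*(y*z)\vee x\sqsubseteq^* y\vee x\sqsubseteq^* z))$; (WQT*7) $\forall z\,(z\sqsubseteq^* a\leftrightarrow z=a)$; (WQT*8) $\forall x,y\,(x\sqsubseteq^* y\wedge y\sqsubseteq^* x\to x=y)$; (WQT*9) $\forall x,y,z\,(x\sqsubseteq^* y\wedge y\sqsubseteq^* z\to x\sqsubseteq^* z)$. -}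

module Defs where

open import Data.Nat using (ℕ; zero; suc)
open import Data.List using (List; []; _∷_; map)
open import Data.List.Membership.Propositional using (_∈_)
open import Data.List.Relation.Unary.All using (All)
open import Data.Product using (Σ; _×_)
open import Function using (_∘_)

data Tm : Set where
  var : ℕ → Tm
  a b : Tm
  _∗_ : Tm → Tm → Tm

infixl 7 _∗_

data CTm : Set where
  ca cb : CTm
  _⊛_ : CTm → CTm → CTm

⌜_⌝ : CTm → Tm
⌜ ca ⌝ = a
⌜ cb ⌝ = b
⌜ s ⊛ t ⌝ = ⌜ s ⌝ ∗ ⌜ t ⌝

data Fm : Set where
  _≐_ _⊑_ : Tm → Tm → Fm
  ⊥'      : Fm
  _⇒_ _∧'_ _∨'_ : Fm → Fm → Fm
  ∀' ∃'   : Fm → Fm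

infix  6 _≐_ _⊑_
infixr 5 _∧'_
infixr 4 _∨'_
infixr 3 _⇒_

¬' : Fm → Fm
¬' φ = φ ⇒ ⊥'

_⇔_ : Fm → Fm → Fm
φ ⇔ ψ = (φ ⇒ ψ) ∧' (ψ ⇒ φ)
infix 2 _⇔_

Sub : Set
Sub = ℕ → Tm

_⟨_⟩ₜ : Tm → Sub → Tm
var n ⟨ σ ⟩ₜ = σ n
a ⟨ σ ⟩ₜ = a
b ⟨ σ ⟩ₜ = b
(s ∗ t) ⟨ σ ⟩ₜ = (s ⟨ σ ⟩ₜ) ∗ (t ⟨ σ ⟩ₜ)

shiftₜ : Tm → Tm
shiftₜ t = t ⟨ var ∘ suc ⟩ₜ

lift : Sub → Sub
lift σ zero = var zero
lift σ (suc n) = shiftₜ (σ n)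

_⟨_⟩ : Fm → Sub → Fm
(s ≐ t) ⟨ σ ⟩ = (s ⟨ σ ⟩ₜ) ≐ (t ⟨ σ ⟩ₜ)
(s ⊑ t) ⟨ σ ⟩ = (s ⟨ σ ⟩ₜ) ⊑ (t ⟨ σ ⟩ₜ)
⊥' ⟨ σ ⟩ = ⊥'
(φ ⇒ ψ) ⟨ σ ⟩ = (φ ⟨ σ ⟩) ⇒ (ψ ⟨ σ ⟩)
(φ ∧' ψ) ⟨ σ ⟩ = (φ ⟨ σ ⟩) ∧' (ψ ⟨ σ ⟩)
(φ ∨' ψ) ⟨ σ ⟩ = (φ ⟨ σ ⟩) ∨' (ψ ⟨ σ ⟩)
∀' φ ⟨ σ ⟩ = ∀' (φ ⟨ lift σ ⟩)
∃' φ ⟨ σ ⟩ = ∃' (φ ⟨ lift σ ⟩)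

shift : Fm → Fm
shift φ = φ ⟨ var ∘ suc ⟩

single : Tm → Sub
single t zero = t
single t (suc n) = var n

_[_] : Fm → Tm → Fm
φ [ t ] = φ ⟨ single t ⟩

infix 1 _⊢_
data _⊢_ (Γ : List Fm) : Fm → Set where
  ass  : ∀ {φ} → φ ∈ Γ → Γ ⊢ φ
  ⇒I   : ∀ {φ ψ} → (φ ∷ Γ) ⊢ ψ → Γ ⊢ φ ⇒ ψ
  ⇒E   : ∀ {φ ψ} → Γ ⊢ φ ⇒ ψ → Γ ⊢ φ → Γ ⊢ ψ
  ∧I   : ∀ {φ ψ} → Γ ⊢ φ → Γ ⊢ ψ → Γ ⊢ φ ∧' ψ
  ∧E₁  : ∀ {φ ψ} → Γ ⊢ φ ∧' ψ → Γ ⊢ φ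
  ∧E₂  : ∀ {φ ψ} → Γ ⊢ φ ∧' ψ → Γ ⊢ ψ
  ∨I₁  : ∀ {φ ψ} → Γ ⊢ φ → Γ ⊢ φ ∨' ψ
  ∨I₂  : ∀ {φ ψ} → Γ ⊢ ψ → Γ ⊢ φ ∨' ψ
  ∨E   : ∀ {φ ψ χ} → Γ ⊢ φ ∨' ψ → (φ ∷ Γ) ⊢ χ → (ψ ∷ Γ) ⊢ χ → Γ ⊢ χ
  ⊥E   : ∀ {φ} → Γ ⊢ ⊥' → Γ ⊢ φ
  raa  : ∀ {φ} → (¬' φ ∷ Γ) ⊢ ⊥' → Γ ⊢ φ
  ∀I   : ∀ {φ} → map shift Γ ⊢ φ → Γ ⊢ ∀' φ
  ∀E   : ∀ {φ} (t : Tm) → Γ ⊢ ∀' φ → Γ ⊢ φ [ t ]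
  ∃I   : ∀ {φ} (t : Tm) → Γ ⊢ φ [ t ] → Γ ⊢ ∃' φ
  ∃E   : ∀ {φ ψ} → Γ ⊢ ∃' φ → (φ ∷ map shift Γ) ⊢ shift ψ → Γ ⊢ ψ
  ≐refl : ∀ {t} → Γ ⊢ t ≐ t
  ≐subst : ∀ {φ s t} → Γ ⊢ s ≐ t → Γ ⊢ φ [ s ] → Γ ⊢ φ [ t ]

-- Defined formulas of the paper (arguments are arbitrary terms;
-- the macros shift them under the quantifiers they introduce)

shift2ₜ : Tm → Tm
shift2ₜ t = shiftₜ (shiftₜ t)

B : Tm → Tm → Fm
B x y = ∃' (shiftₜ y ≐ shiftₜ x ∗ var 0)

E : Tm → Tm → Fm
E x y = ∃' (shiftₜ y ≐ var 0 ∗ shiftₜ x)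

_⊆p_ : Tm → Tm → Fm
x ⊆p y = (x ≐ y) ∨' B x y ∨' E x y
         ∨' ∃' (∃' (shift2ₜ y ≐ var 1 ∗ (shift2ₜ x ∗ var 0)))
         ∨' ∃' (∃' (shift2ₜ y ≐ (var 1 ∗ shift2ₜ x) ∗ var 0))
infix 6 _⊆p_

private
  x₀ x₁ x₂ : Tm
  x₀ = var 0
  x₁ = var 1
  x₂ = var 2

ax1 : CTm → Fm
ax1 c = ∀' (∀' (∀' (let t = ⌜ c ⌝ ; x = x₂ ; y = x₁ ; z = x₀ in
  ((x ∗ (y ∗ z)) ⊆p t ∨' ((x ∗ y) ∗ z) ⊆p t) ⇒ x ∗ (y ∗ z) ≐ (x ∗ y) ∗ z)))

ax2 : CTm → Fm
ax2 c = ∀' (∀' (let t = ⌜ c ⌝ ; x = x₁ ; y = x₀ in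
  (x ∗ y) ⊆p t ⇒ (¬' (x ∗ y ≐ a) ∧' ¬' (x ∗ y ≐ b))))

ax3 : CTm → Fm
ax3 c = ∀' (∀' (let t = ⌜ c ⌝ ; x = x₁ ; y = x₀ in
     (((a ∗ x) ⊆p t ∧' (a ∗ y) ⊆p t) ⇒ (a ∗ x ≐ a ∗ y ⇒ x ≐ y))
  ∧' (((b ∗ x) ⊆p t ∧' (b ∗ y) ⊆p t) ⇒ (b ∗ x ≐ b ∗ y ⇒ x ≐ y))
  ∧' (((x ∗ a) ⊆p t ∧' (y ∗ a) ⊆p t) ⇒ (x ∗ a ≐ y ∗ a ⇒ x ≐ y))
  ∧' (((x ∗ b) ⊆p t ∧' (y ∗ b) ⊆p t) ⇒ (x ∗ b ≐ y ∗ b ⇒ x ≐ y))))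

ax4 : CTm → Fm
ax4 c = ∀' (∀' (let t = ⌜ c ⌝ ; x = x₁ ; y = x₀ in
     (((a ∗ x) ⊆p t ∧' (b ∗ y) ⊆p t) ⇒ ¬' (a ∗ x ≐ b ∗ y))
  ∧' (((x ∗ a) ⊆p t ∧' (y ∗ b) ⊆p t) ⇒ ¬' (x ∗ a ≐ y ∗ b))))

ax5 : CTm → Fm
ax5 c = ∀' (let t = ⌜ c ⌝ ; x = x₀ in
  x ⊆p t ⇒ (x ≐ a ∨' x ≐ b ∨' ((B a x ∨' B b x) ∧' (E a x ∨' E b x))))

ax6 : CTm → Fm
ax6 c = ∀' (∀' (let t = ⌜ c ⌝ ; y = x₁ ; z = x₀ in
  (b ∗ (y ∗ z)) ⊆p t ⇒
    ∀' (let x = x₀ ; y' = x₂ ; z' = x₁ in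
      (x ⊑ b ∗ (y' ∗ z')) ⇔ (x ≐ b ∗ (y' ∗ z') ∨' x ⊑ y' ∨' x ⊑ z'))))

ax7 : Fm
ax7 = ∀' (x₀ ⊑ a ⇔ x₀ ≐ a)

ax8 : Fm
ax8 = ∀' (∀' (let x = x₁ ; y = x₀ in (x ⊑ y ∧' y ⊑ x) ⇒ x ≐ y))

ax9 : Fm
ax9 = ∀' (∀' (∀' (let x = x₂ ; y = x₁ ; z = x₀ in (x ⊑ y ∧' y ⊑ z) ⇒ x ⊑ z)))

data WQT* : Fm → Set where
  wqt1 : ∀ t → WQT* (ax1 t)
  wqt2 : ∀ t → WQT* (ax2 t)
  wqt3 : ∀ t → WQT* (ax3 t)
  wqt4 : ∀ t → WQT* (ax4 t)
  wqt5 : ∀ t → WQT* (ax5 t)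
  wqt6 : ∀ t → WQT* (ax6 t)
  wqt7 : WQT* ax7
  wqt8 : WQT* ax8
  wqt9 : WQT* ax9

_⊩_ : (Fm → Set) → Fm → Set
T ⊩ φ = Σ (List Fm) (λ Γ → All T Γ × (Γ ⊢ φ))
infix 1 _⊩_

data LT : Set where
  0ᴸ   : LT
  pair : LT → LT → LT

τ : LT → CTm
τ 0ᴸ = ca
τ (pair u v) = cb ⊛ (τ u ⊛ τ v)

-- WQT* proves, for closed terms, that ∗ is associative, that a ∗ _ and b ∗ _ are
-- injective and that their ranges are disjoint: each axiom instance is taken with t the
-- very term it speaks about, so its ⊆p guard holds by reflexivity. As
-- ⌜ τ (pair p q) ⌝ ∗ x ≐ b ∗ (⌜ τ p ⌝ ∗ (⌜ τ q ⌝ ∗ x)), an equation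
-- ⌜ τ p ⌝ ∗ x ≐ ⌜ τ q ⌝ ∗ y can be peeled one constructor at a time: equal heads cancel,
-- and the first mismatch is an equation a ∗ _ ≐ b ∗ _, which is refutable. Appending a
-- to both sides of ⌜ τ u ⌝ ≐ ⌜ τ v ⌝ brings the theorem into this form.
module Submission where

open import Defs
open import Data.Empty using (⊥-elim)
open import Data.List using (List; []; _∷_; _++_)
open import Data.List.Relation.Binary.Subset.Propositional using (_⊆_)
open import Data.List.Relation.Binary.Subset.Propositional.Properties
  using (map⁺; ∷⁺ʳ; ++⁺ʳ; xs⊆xs++ys; xs⊆ys++xs)
open import Data.List.Relation.Unary.All using (All; []; _∷_)
open import Data.List.Relation.Unary.All.Properties using (++⁺)
open import Data.List.Relation.Unary.Any using (here)
open import Data.Product using (Σ; _×_; _,_)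
open import Function using (_∘_)
open import Relation.Binary.Definitions using (DecidableEquality)
open import Relation.Binary.PropositionalEquality
  using (_≡_; _≢_; refl; trans; cong; cong₂; subst; module ≡-Reasoning)
open import Relation.Nullary using (yes; no)

weaken : ∀ {Γ Δ φ} → Γ ⊆ Δ → Γ ⊢ φ → Δ ⊢ φ
weaken ρ (ass m) = ass (ρ m)
weaken ρ (⇒I d) = ⇒I (weaken (∷⁺ʳ _ ρ) d)
weaken ρ (⇒E d e) = ⇒E (weaken ρ d) (weaken ρ e)
weaken ρ (∧I d e) = ∧I (weaken ρ d) (weaken ρ e)
weaken ρ (∧E₁ d) = ∧E₁ (weaken ρ d)
weaken ρ (∧E₂ d) = ∧E₂ (weaken ρ d)
weaken ρ (∨I₁ d) = ∨I₁ (weaken ρ d)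
weaken ρ (∨I₂ d) = ∨I₂ (weaken ρ d)
weaken ρ (∨E d e f) = ∨E (weaken ρ d) (weaken (∷⁺ʳ _ ρ) e) (weaken (∷⁺ʳ _ ρ) f)
weaken ρ (⊥E d) = ⊥E (weaken ρ d)
weaken ρ (raa d) = raa (weaken (∷⁺ʳ _ ρ) d)
weaken ρ (∀I d) = ∀I (weaken (map⁺ shift ρ) d)
weaken ρ (∀E t d) = ∀E t (weaken ρ d)
weaken ρ (∃I t d) = ∃I t (weaken ρ d)
weaken ρ (∃E d e) = ∃E (weaken ρ d) (weaken (∷⁺ʳ _ (map⁺ shift ρ)) e)
weaken ρ ≐refl = ≐refl
weaken ρ (≐subst d e) = ≐subst (weaken ρ d) (weaken ρ e)

_∣_⊩_ : (Fm → Set) → List Fm → Fm → Set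
T ∣ Δ ⊩ φ = Σ (List Fm) λ Γ → All T Γ × (Δ ++ Γ ⊢ φ)
infix 1 _∣_⊩_

module _ {T : Fm → Set} {Δ : List Fm} where

  ⊩-axiom : ∀ {φ} → T φ → T ∣ Δ ⊩ φ
  ⊩-axiom t = _ ∷ [] , t ∷ [] , ass (xs⊆ys++xs _ Δ (here refl))

  ⊩-hypothesis : ∀ {φ} → T ∣ φ ∷ Δ ⊩ φ
  ⊩-hypothesis = [] , [] , ass (here refl)

  ⊩-map : ∀ {φ ψ} → (∀ {Γ} → Γ ⊢ φ → Γ ⊢ ψ) → T ∣ Δ ⊩ φ → T ∣ Δ ⊩ ψ
  ⊩-map f (Γ , ts , d) = Γ , ts , f d

  ⊩-map₂ : ∀ {φ ψ χ} → (∀ {Γ} → Γ ⊢ φ → Γ ⊢ ψ → Γ ⊢ χ) →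
           T ∣ Δ ⊩ φ → T ∣ Δ ⊩ ψ → T ∣ Δ ⊩ χ
  ⊩-map₂ f (Γ₁ , ts₁ , d₁) (Γ₂ , ts₂ , d₂) =
    Γ₁ ++ Γ₂ , ++⁺ ts₁ ts₂ ,
    f (weaken (++⁺ʳ Δ (xs⊆xs++ys Γ₁ Γ₂)) d₁) (weaken (++⁺ʳ Δ (xs⊆ys++xs Γ₂ Γ₁)) d₂)

⊩-⇒I : ∀ {T Δ φ ψ} → T ∣ φ ∷ Δ ⊩ ψ → T ∣ Δ ⊩ φ ⇒ ψ
⊩-⇒I (Γ , ts , d) = Γ , ts , ⇒I d

shiftₜ-⟨single⟩ : ∀ s t → shiftₜ s ⟨ single t ⟩ₜ ≡ s
shiftₜ-⟨single⟩ (var n) t = refl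
shiftₜ-⟨single⟩ a t = refl
shiftₜ-⟨single⟩ b t = refl
shiftₜ-⟨single⟩ (s ∗ s′) t = cong₂ _∗_ (shiftₜ-⟨single⟩ s t) (shiftₜ-⟨single⟩ s′ t)

shiftₜ-⟨lift⟩ : ∀ t σ → shiftₜ t ⟨ lift σ ⟩ₜ ≡ shiftₜ (t ⟨ σ ⟩ₜ)
shiftₜ-⟨lift⟩ (var n) σ = refl
shiftₜ-⟨lift⟩ a σ = refl
shiftₜ-⟨lift⟩ b σ = refl
shiftₜ-⟨lift⟩ (s ∗ s′) σ = cong₂ _∗_ (shiftₜ-⟨lift⟩ s σ) (shiftₜ-⟨lift⟩ s′ σ)

shift2ₜ-⟨lift⟩ : ∀ t σ → shift2ₜ t ⟨ lift (lift σ) ⟩ₜ ≡ shift2ₜ (t ⟨ σ ⟩ₜ)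
shift2ₜ-⟨lift⟩ t σ = trans (shiftₜ-⟨lift⟩ (shiftₜ t) (lift σ)) (cong shiftₜ (shiftₜ-⟨lift⟩ t σ))

⌜⌝-⟨⟩ : ∀ c σ → ⌜ c ⌝ ⟨ σ ⟩ₜ ≡ ⌜ c ⌝
⌜⌝-⟨⟩ ca σ = refl
⌜⌝-⟨⟩ cb σ = refl
⌜⌝-⟨⟩ (c ⊛ d) σ = cong₂ _∗_ (⌜⌝-⟨⟩ c σ) (⌜⌝-⟨⟩ d σ)

⊆p-⟨⟩ : ∀ x y σ → (x ⊆p y) ⟨ σ ⟩ ≡ (x ⟨ σ ⟩ₜ) ⊆p (y ⟨ σ ⟩ₜ)
⊆p-⟨⟩ x y σ rewrite shift2ₜ-⟨lift⟩ x σ | shift2ₜ-⟨lift⟩ y σ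
                   | shiftₜ-⟨lift⟩ x σ | shiftₜ-⟨lift⟩ y σ = refl

⊆p-refl : ∀ {Γ t} → Γ ⊢ t ⊆p t
⊆p-refl = ∨I₁ ≐refl

≐-subst : ∀ {Γ s t ψ χ} φ → φ [ s ] ≡ ψ → φ [ t ] ≡ χ → Γ ⊢ s ≐ t → Γ ⊢ ψ → Γ ⊢ χ
≐-subst φ refl refl = ≐subst

≐-sym : ∀ {Γ s t} → Γ ⊢ s ≐ t → Γ ⊢ t ≐ s
≐-sym {s = s} {t} d =
  ≐-subst (var 0 ≐ shiftₜ s)
    (cong (s ≐_) (shiftₜ-⟨single⟩ s s)) (cong (t ≐_) (shiftₜ-⟨single⟩ s t)) d ≐refl

≐-trans : ∀ {Γ s t r} → Γ ⊢ s ≐ t → Γ ⊢ t ≐ r → Γ ⊢ s ≐ r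
≐-trans {s = s} {t} {r} d e =
  ≐-subst (shiftₜ s ≐ var 0)
    (cong (_≐ t) (shiftₜ-⟨single⟩ s t)) (cong (_≐ r) (shiftₜ-⟨single⟩ s r)) e d

∗-congˡ : ∀ {Γ s t} r → Γ ⊢ s ≐ t → Γ ⊢ r ∗ s ≐ r ∗ t
∗-congˡ {s = s} {t} r d =
  ≐-subst (shiftₜ (r ∗ s) ≐ shiftₜ r ∗ var 0)
    (cong₂ _≐_ (shiftₜ-⟨single⟩ (r ∗ s) s) (cong (_∗ s) (shiftₜ-⟨single⟩ r s)))
    (cong₂ _≐_ (shiftₜ-⟨single⟩ (r ∗ s) t) (cong (_∗ t) (shiftₜ-⟨single⟩ r t))) d ≐refl

∗-congʳ : ∀ {Γ s t} r → Γ ⊢ s ≐ t → Γ ⊢ s ∗ r ≐ t ∗ r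
∗-congʳ {s = s} {t} r d =
  ≐-subst (shiftₜ (s ∗ r) ≐ var 0 ∗ shiftₜ r)
    (cong₂ _≐_ (shiftₜ-⟨single⟩ (s ∗ r) s) (cong (s ∗_) (shiftₜ-⟨single⟩ r s)))
    (cong₂ _≐_ (shiftₜ-⟨single⟩ (s ∗ r) t) (cong (t ∗_) (shiftₜ-⟨single⟩ r t))) d ≐refl

SubstCommuting₃ : (Tm → Tm → Tm → Fm) → Set
SubstCommuting₃ F = ∀ x y t σ → F x y t ⟨ σ ⟩ ≡ F (x ⟨ σ ⟩ₜ) (y ⟨ σ ⟩ₜ) (t ⟨ σ ⟩ₜ)

SubstCommuting₄ : (Tm → Tm → Tm → Tm → Fm) → Set
SubstCommuting₄ F =
  ∀ x y z t σ → F x y z t ⟨ σ ⟩ ≡ F (x ⟨ σ ⟩ₜ) (y ⟨ σ ⟩ₜ) (z ⟨ σ ⟩ₜ) (t ⟨ σ ⟩ₜ)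

∀E₂-closed : ∀ {Γ} F → SubstCommuting₃ F → ∀ c x y →
             Γ ⊢ ∀' (∀' (F (var 1) (var 0) ⌜ c ⌝)) → Γ ⊢ F x y ⌜ c ⌝
∀E₂-closed {Γ} F F-comm c x y d = subst (Γ ⊢_) instance≡ (∀E y (∀E x d))
  where
  open ≡-Reasoning
  σ₁ σ₂ : Sub
  σ₁ = lift (single x)
  σ₂ = single y
  instance≡ : F (var 1) (var 0) ⌜ c ⌝ ⟨ σ₁ ⟩ ⟨ σ₂ ⟩ ≡ F x y ⌜ c ⌝
  instance≡ = begin
    F (var 1) (var 0) ⌜ c ⌝ ⟨ σ₁ ⟩ ⟨ σ₂ ⟩
      ≡⟨ cong (_⟨ σ₂ ⟩) (F-comm (var 1) (var 0) ⌜ c ⌝ σ₁) ⟩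
    F (shiftₜ x) (var 0) (⌜ c ⌝ ⟨ σ₁ ⟩ₜ) ⟨ σ₂ ⟩
      ≡⟨ F-comm (shiftₜ x) (var 0) (⌜ c ⌝ ⟨ σ₁ ⟩ₜ) σ₂ ⟩
    F (shiftₜ x ⟨ σ₂ ⟩ₜ) y (⌜ c ⌝ ⟨ σ₁ ⟩ₜ ⟨ σ₂ ⟩ₜ)
      ≡⟨ cong₂ (λ x′ c′ → F x′ y (c′ ⟨ σ₂ ⟩ₜ)) (shiftₜ-⟨single⟩ x y) (⌜⌝-⟨⟩ c σ₁) ⟩
    F x y (⌜ c ⌝ ⟨ σ₂ ⟩ₜ)
      ≡⟨ cong (F x y) (⌜⌝-⟨⟩ c σ₂) ⟩
    F x y ⌜ c ⌝ ∎

∀E₃-closed : ∀ {Γ} F → SubstCommuting₄ F → ∀ c x y z →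
             Γ ⊢ ∀' (∀' (∀' (F (var 2) (var 1) (var 0) ⌜ c ⌝))) → Γ ⊢ F x y z ⌜ c ⌝
∀E₃-closed {Γ} F F-comm c x y z d = subst (Γ ⊢_) instance≡ (∀E z (∀E y (∀E x d)))
  where
  open ≡-Reasoning
  σ₁ σ₂ σ₃ : Sub
  σ₁ = lift (lift (single x))
  σ₂ = lift (single y)
  σ₃ = single z
  x≡ : shift2ₜ x ⟨ σ₂ ⟩ₜ ⟨ σ₃ ⟩ₜ ≡ x
  x≡ rewrite shiftₜ-⟨lift⟩ (shiftₜ x) (single y) | shiftₜ-⟨single⟩ x y = shiftₜ-⟨single⟩ x z
  c≡ : ⌜ c ⌝ ⟨ σ₁ ⟩ₜ ⟨ σ₂ ⟩ₜ ⟨ σ₃ ⟩ₜ ≡ ⌜ c ⌝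
  c≡ rewrite ⌜⌝-⟨⟩ c σ₁ | ⌜⌝-⟨⟩ c σ₂ = ⌜⌝-⟨⟩ c σ₃
  instance≡ : F (var 2) (var 1) (var 0) ⌜ c ⌝ ⟨ σ₁ ⟩ ⟨ σ₂ ⟩ ⟨ σ₃ ⟩ ≡ F x y z ⌜ c ⌝
  instance≡ = begin
    F (var 2) (var 1) (var 0) ⌜ c ⌝ ⟨ σ₁ ⟩ ⟨ σ₂ ⟩ ⟨ σ₃ ⟩
      ≡⟨ cong (λ φ → φ ⟨ σ₂ ⟩ ⟨ σ₃ ⟩) (F-comm (var 2) (var 1) (var 0) ⌜ c ⌝ σ₁) ⟩
    F (shift2ₜ x) (var 1) (var 0) (⌜ c ⌝ ⟨ σ₁ ⟩ₜ) ⟨ σ₂ ⟩ ⟨ σ₃ ⟩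
      ≡⟨ cong (_⟨ σ₃ ⟩) (F-comm (shift2ₜ x) (var 1) (var 0) (⌜ c ⌝ ⟨ σ₁ ⟩ₜ) σ₂) ⟩
    F (shift2ₜ x ⟨ σ₂ ⟩ₜ) (shiftₜ y) (var 0) (⌜ c ⌝ ⟨ σ₁ ⟩ₜ ⟨ σ₂ ⟩ₜ) ⟨ σ₃ ⟩
      ≡⟨ F-comm (shift2ₜ x ⟨ σ₂ ⟩ₜ) (shiftₜ y) (var 0) (⌜ c ⌝ ⟨ σ₁ ⟩ₜ ⟨ σ₂ ⟩ₜ) σ₃ ⟩
    F (shift2ₜ x ⟨ σ₂ ⟩ₜ ⟨ σ₃ ⟩ₜ) (shiftₜ y ⟨ σ₃ ⟩ₜ) z (⌜ c ⌝ ⟨ σ₁ ⟩ₜ ⟨ σ₂ ⟩ₜ ⟨ σ₃ ⟩ₜ)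
      ≡⟨ cong₂ (λ x′ y′ → F x′ y′ z (⌜ c ⌝ ⟨ σ₁ ⟩ₜ ⟨ σ₂ ⟩ₜ ⟨ σ₃ ⟩ₜ)) x≡ (shiftₜ-⟨single⟩ y z) ⟩
    F x y z (⌜ c ⌝ ⟨ σ₁ ⟩ₜ ⟨ σ₂ ⟩ₜ ⟨ σ₃ ⟩ₜ)
      ≡⟨ cong (F x y z) c≡ ⟩
    F x y z ⌜ c ⌝ ∎

-- Matrices of ax1, ax3 and ax4: e.g. ax1 c is definitionally
-- ∀' (∀' (∀' (AssocWithin (var 2) (var 1) (var 0) ⌜ c ⌝))).
AssocWithin : Tm → Tm → Tm → Tm → Fm
AssocWithin x y z t =
  ((x ∗ (y ∗ z)) ⊆p t ∨' ((x ∗ y) ∗ z) ⊆p t) ⇒ x ∗ (y ∗ z) ≐ (x ∗ y) ∗ z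

CancelWithin : Tm → Tm → Tm → Fm
CancelWithin x y t =
     (((a ∗ x) ⊆p t ∧' (a ∗ y) ⊆p t) ⇒ (a ∗ x ≐ a ∗ y ⇒ x ≐ y))
  ∧' (((b ∗ x) ⊆p t ∧' (b ∗ y) ⊆p t) ⇒ (b ∗ x ≐ b ∗ y ⇒ x ≐ y))
  ∧' (((x ∗ a) ⊆p t ∧' (y ∗ a) ⊆p t) ⇒ (x ∗ a ≐ y ∗ a ⇒ x ≐ y))
  ∧' (((x ∗ b) ⊆p t ∧' (y ∗ b) ⊆p t) ⇒ (x ∗ b ≐ y ∗ b ⇒ x ≐ y))

DisjointWithin : Tm → Tm → Tm → Fm
DisjointWithin x y t =
     (((a ∗ x) ⊆p t ∧' (b ∗ y) ⊆p t) ⇒ ¬' (a ∗ x ≐ b ∗ y))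
  ∧' (((x ∗ a) ⊆p t ∧' (y ∗ b) ⊆p t) ⇒ ¬' (x ∗ a ≐ y ∗ b))

AssocWithin-⟨⟩ : SubstCommuting₄ AssocWithin
AssocWithin-⟨⟩ x y z t σ rewrite ⊆p-⟨⟩ (x ∗ (y ∗ z)) t σ | ⊆p-⟨⟩ ((x ∗ y) ∗ z) t σ = refl

CancelWithin-⟨⟩ : SubstCommuting₃ CancelWithin
CancelWithin-⟨⟩ x y t σ
  rewrite ⊆p-⟨⟩ (a ∗ x) t σ | ⊆p-⟨⟩ (a ∗ y) t σ | ⊆p-⟨⟩ (b ∗ x) t σ | ⊆p-⟨⟩ (b ∗ y) t σ
        | ⊆p-⟨⟩ (x ∗ a) t σ | ⊆p-⟨⟩ (y ∗ a) t σ | ⊆p-⟨⟩ (x ∗ b) t σ | ⊆p-⟨⟩ (y ∗ b) t σ = refl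

DisjointWithin-⟨⟩ : SubstCommuting₃ DisjointWithin
DisjointWithin-⟨⟩ x y t σ
  rewrite ⊆p-⟨⟩ (a ∗ x) t σ | ⊆p-⟨⟩ (b ∗ y) t σ | ⊆p-⟨⟩ (x ∗ a) t σ | ⊆p-⟨⟩ (y ∗ b) t σ = refl

⇒E-guarded : ∀ {Γ s t χ} → Γ ⊢ (s ⊆p s ∧' t ⊆p s) ⇒ (s ≐ t ⇒ χ) → Γ ⊢ s ≐ t → Γ ⊢ χ
⇒E-guarded g e = ⇒E (⇒E g (∧I ⊆p-refl (∨I₁ (≐-sym e)))) e

_≟_ : DecidableEquality LT
0ᴸ ≟ 0ᴸ = yes refl
0ᴸ ≟ pair _ _ = no λ ()
pair _ _ ≟ 0ᴸ = no λ ()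
pair p q ≟ pair p′ q′ with p ≟ p′ | q ≟ q′
... | yes refl | yes refl = yes refl
... | no p≢p′ | _ = no λ { refl → p≢p′ refl }
... | _ | no q≢q′ = no λ { refl → q≢q′ refl }

module _ {Δ : List Fm} where

  ∗-assoc : ∀ x y z → WQT* ∣ Δ ⊩ ⌜ x ⌝ ∗ (⌜ y ⌝ ∗ ⌜ z ⌝) ≐ (⌜ x ⌝ ∗ ⌜ y ⌝) ∗ ⌜ z ⌝
  ∗-assoc x y z =
    ⊩-map (λ ax → ⇒E (∀E₃-closed AssocWithin AssocWithin-⟨⟩ ((x ⊛ y) ⊛ z) ⌜ x ⌝ ⌜ y ⌝ ⌜ z ⌝ ax)
                     (∨I₂ ⊆p-refl))
          (⊩-axiom (wqt1 ((x ⊛ y) ⊛ z)))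

  a∗-cancel : ∀ x y → WQT* ∣ Δ ⊩ a ∗ ⌜ x ⌝ ≐ a ∗ ⌜ y ⌝ → WQT* ∣ Δ ⊩ ⌜ x ⌝ ≐ ⌜ y ⌝
  a∗-cancel x y =
    ⊩-map₂ (⇒E-guarded ∘ ∧E₁ ∘ ∀E₂-closed CancelWithin CancelWithin-⟨⟩ (ca ⊛ x) ⌜ x ⌝ ⌜ y ⌝)
           (⊩-axiom (wqt3 (ca ⊛ x)))

  b∗-cancel : ∀ x y → WQT* ∣ Δ ⊩ b ∗ ⌜ x ⌝ ≐ b ∗ ⌜ y ⌝ → WQT* ∣ Δ ⊩ ⌜ x ⌝ ≐ ⌜ y ⌝
  b∗-cancel x y =
    ⊩-map₂ (⇒E-guarded ∘ ∧E₁ ∘ ∧E₂ ∘ ∀E₂-closed CancelWithin CancelWithin-⟨⟩ (cb ⊛ x) ⌜ x ⌝ ⌜ y ⌝)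
           (⊩-axiom (wqt3 (cb ⊛ x)))

  a∗≠b∗ : ∀ x y → WQT* ∣ Δ ⊩ a ∗ ⌜ x ⌝ ≐ b ∗ ⌜ y ⌝ → WQT* ∣ Δ ⊩ ⊥'
  a∗≠b∗ x y =
    ⊩-map₂ (⇒E-guarded ∘ ∧E₁ ∘ ∀E₂-closed DisjointWithin DisjointWithin-⟨⟩ (ca ⊛ x) ⌜ x ⌝ ⌜ y ⌝)
           (⊩-axiom (wqt4 (ca ⊛ x)))

  pair∗-unfold : ∀ p q x →
    WQT* ∣ Δ ⊩ ⌜ τ (pair p q) ⌝ ∗ ⌜ x ⌝ ≐ b ∗ (⌜ τ p ⌝ ∗ (⌜ τ q ⌝ ∗ ⌜ x ⌝))
  pair∗-unfold p q x =
    ⊩-map₂ ≐-trans (⊩-map ≐-sym (∗-assoc cb (τ p ⊛ τ q) x))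
                   (⊩-map (∗-congˡ b ∘ ≐-sym) (∗-assoc (τ p) (τ q) x))

  pair∗-cancel : ∀ p₁ p₂ q₁ q₂ x y →
    WQT* ∣ Δ ⊩ ⌜ τ (pair p₁ p₂) ⌝ ∗ ⌜ x ⌝ ≐ ⌜ τ (pair q₁ q₂) ⌝ ∗ ⌜ y ⌝ →
    WQT* ∣ Δ ⊩ ⌜ τ p₁ ⌝ ∗ (⌜ τ p₂ ⌝ ∗ ⌜ x ⌝) ≐ ⌜ τ q₁ ⌝ ∗ (⌜ τ q₂ ⌝ ∗ ⌜ y ⌝)
  pair∗-cancel p₁ p₂ q₁ q₂ x y e =
    b∗-cancel (τ p₁ ⊛ (τ p₂ ⊛ x)) (τ q₁ ⊛ (τ q₂ ⊛ y))
      (⊩-map₂ ≐-trans (⊩-map ≐-sym (pair∗-unfold p₁ p₂ x))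
                      (⊩-map₂ ≐-trans e (pair∗-unfold q₁ q₂ y)))

  τ∗-cancelˡ : ∀ p x y → WQT* ∣ Δ ⊩ ⌜ τ p ⌝ ∗ ⌜ x ⌝ ≐ ⌜ τ p ⌝ ∗ ⌜ y ⌝ → WQT* ∣ Δ ⊩ ⌜ x ⌝ ≐ ⌜ y ⌝
  τ∗-cancelˡ 0ᴸ x y = a∗-cancel x y
  τ∗-cancelˡ (pair p q) x y =
    τ∗-cancelˡ q x y ∘ τ∗-cancelˡ p (τ q ⊛ x) (τ q ⊛ y) ∘ pair∗-cancel p q p q x y

  τ∗-apart : ∀ p q x y → p ≢ q →
    WQT* ∣ Δ ⊩ ⌜ τ p ⌝ ∗ ⌜ x ⌝ ≐ ⌜ τ q ⌝ ∗ ⌜ y ⌝ → WQT* ∣ Δ ⊩ ⊥'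
  τ∗-apart 0ᴸ 0ᴸ x y p≢q e = ⊥-elim (p≢q refl)
  τ∗-apart 0ᴸ (pair q₁ q₂) x y p≢q e =
    a∗≠b∗ x (τ q₁ ⊛ (τ q₂ ⊛ y)) (⊩-map₂ ≐-trans e (pair∗-unfold q₁ q₂ y))
  τ∗-apart (pair p₁ p₂) 0ᴸ x y p≢q e =
    a∗≠b∗ y (τ p₁ ⊛ (τ p₂ ⊛ x)) (⊩-map₂ ≐-trans (⊩-map ≐-sym e) (pair∗-unfold p₁ p₂ x))
  τ∗-apart (pair p₁ p₂) (pair q₁ q₂) x y p≢q e with p₁ ≟ q₁
  ... | yes refl = τ∗-apart p₂ q₂ x y (p≢q ∘ cong (pair p₁))
                     (τ∗-cancelˡ p₁ (τ p₂ ⊛ x) (τ q₂ ⊛ y) (pair∗-cancel p₁ p₂ q₁ q₂ x y e))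
  ... | no p₁≢q₁ = τ∗-apart p₁ q₁ (τ p₂ ⊛ x) (τ q₂ ⊛ y) p₁≢q₁ (pair∗-cancel p₁ p₂ q₁ q₂ x y e)

mainTheorem9 : (u v : LT) → τ u ≢ τ v → WQT* ⊩ ¬' (⌜ τ u ⌝ ≐ ⌜ τ v ⌝)
mainTheorem9 u v τu≢τv =
  ⊩-⇒I (τ∗-apart u v ca ca (τu≢τv ∘ cong τ) (⊩-map (∗-congʳ a) ⊩-hypothesis))
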